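{- The monad $\Lambda$ of untyped $\lambda$-terms modulo $\beta\eta$-equivalence, equipped with the abstraction $\mathsf{abs}\colon\Lambda'\to\Lambda$, is an initial object in the category of exponential monads.
   Context: A monad on $\mathsf{Set}$ is $(R,\mu,\eta)$ with $R\colon\mathsf{Set}\to\mathsf{Set}$ a functor, natural transformations $\mu\colon R\circ R\to R$, $\eta\colon I\to R$ with $\mu\circ R\mu=\mu\circ\mu R$ and $\mu\circ\eta R=\mu\circ R\eta=1_R$; a morphism of monads $\phi\colon P\to R$ is a natural transformation with $\phi\circ\mu_P=\mu_R\circ(\phi\phi)$ and $\phi\circ\eta_P=\eta_R$. A left $R$-module is a functor $M\colon\mathsf{Set}\to\mathsf{Set}$ with natural $\rho\colon M\circ R\to M$ satisfying $\rho\circ M\mu=\rho\circ\rho R$, $\rho\circ M\eta=1_M$; a natural transformation $\tau\colon M\to N$ of left $R$-modules is linear if $\rho_N\circ\tau R=\tau\circ\rho_M$. $R$ is a left $R$-module via $\mu$. The derivative $M'(X)=M(X+\{*\})$ of a left $R$-module $M$ is a left $R$-module with action $M\gamma$ followed by $\rho_{X+\{*\}}$, where $\gamma_X\colon R(X)+\{*\}\to R(X+\{*\})$ is $R(\mathrm{inl})$ on $R(X)$ and sends $*$ to $\eta_{X+\{*\}}(*)$. For a monad morphism $f\colon R\to P$ and left $P$-module $M$, $f^*M$ denotes $M$ with the $R$-action $\rho_M\circ Mf$; base change commutes with derivation. An exponential monad is a monad $R$ on $\mathsf{Set}$ together with an $R$-linear isomorphism $\exp_R\colon R'\to R$. A morphism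 of exponential monads $R\to P$ is a monad morphism $f\colon R\to P$ with $f\circ\exp_R=\exp_P\circ f'$ as morphisms $R'\to f^*P$ of left $R$-modules, where $f'_X=f_{X+\{*\}}$. $\Lambda(X)$ is the set of $\lambda$-terms with free variables in $X$ (modulo $\alpha$-conversion, i.e. terms built from variables in $X$, application, and abstraction $\mathsf{abs}\colon\Lambda(X+\{*\})\to\Lambda(X)$ binding $*$) taken modulo the reflexive symmetric transitive closure of $\beta$- and $\eta$-conversion; it is a monad with unit the variable inclusion and multiplication given by substitution, and $\mathsf{abs}\colon\Lambda'\to\Lambda$ is a $\Lambda$-linear isomorphism (with inverse $x\mapsto\mathsf{app}(\hat x,*)$, $\hat x$ the image of $x$ under $\Lambda(\mathrm{inl})$). -}

module Defs where

open import Level using (0ℓ)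
open import Relation.Binary.Bundles using (Setoid)
open import Function.Bundles using (Func)
open import Data.Sum.Base using (_⊎_; inj₁; inj₂)
import Data.Sum.Base as Sum
open import Data.Sum.Relation.Binary.Pointwise using (Pointwise; inj₁; inj₂; ⊎-setoid)
open import Data.Unit.Base using (⊤; tt)
open import Data.Product.Base using (Σ; _,_)
open import Relation.Binary.PropositionalEquality as PE using (_≡_)

-- "Set" is modelled by setoids (Agda has no quotient types); maps of
-- sets are setoid maps, equality of maps is pointwise ≈.

Obj : Set₁
Obj = Setoid 0ℓ 0ℓ

∣_∣ : Obj → Set
∣ A ∣ = Setoid.Carrier A

_⇒_ : Obj → Obj → Set
A ⇒ B = Func A B

Eq : (A : Obj) → ∣ A ∣ → ∣ A ∣ → Set
Eq A = Setoid._≈_ A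

Cong : (A B : Obj) → (∣ A ∣ → ∣ B ∣) → Set
Cong A B f = ∀ {x y} → Eq A x y → Eq B (f x) (f y)

mk : {A B : Obj} (f : ∣ A ∣ → ∣ B ∣) → Cong A B f → A ⇒ B
mk f c = record { to = f ; cong = c }

idF : {A : Obj} → A ⇒ A
idF = mk (λ x → x) (λ p → p)

_∘F_ : {A B C : Obj} → B ⇒ C → A ⇒ B → A ⇒ C
g ∘F f = mk (λ x → Func.to g (Func.to f x)) (λ p → Func.cong g (Func.cong f p))

One : Obj
One = PE.setoid ⊤

Opt : Obj → Obj
Opt A = ⊎-setoid A One

inlF : {A : Obj} → A ⇒ Opt A
inlF = mk inj₁ inj₁

optF : {A B : Obj} → A ⇒ B → Opt A ⇒ Opt B
optF {A} {B} f = mk (Sum.map (Func.to f) (λ (u : ⊤) → u)) c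
  where
  c : Cong (Opt A) (Opt B) (Sum.map (Func.to f) (λ (u : ⊤) → u))
  c (inj₁ p) = inj₁ (Func.cong f p)
  c (inj₂ q) = inj₂ q

record ExpMonadData : Set₁ where
  field
    R₀  : Obj → Obj
    R₁  : ∀ {A B} → A ⇒ B → ∣ R₀ A ∣ → ∣ R₀ B ∣
    μ   : ∀ A → ∣ R₀ (R₀ A) ∣ → ∣ R₀ A ∣
    η   : ∀ A → ∣ A ∣ → ∣ R₀ A ∣
    exp : ∀ A → ∣ R₀ (Opt A) ∣ → ∣ R₀ A ∣

record Setoidal (D : ExpMonadData) : Set₁ where
  open ExpMonadData D
  field
    R₁-cong  : ∀ {A B} (f : A ⇒ B) → Cong (R₀ A) (R₀ B) (R₁ f)
    μ-cong   : ∀ A → Cong (R₀ (R₀ A)) (R₀ A) (μ A)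
    η-cong   : ∀ A → Cong A (R₀ A) (η A)
    exp-cong : ∀ A → Cong (R₀ (Opt A)) (R₀ A) (exp A)

module Laws (D : ExpMonadData) (s : Setoidal D) where
  open ExpMonadData D
  open Setoidal s

  RF : ∀ {A B} → A ⇒ B → R₀ A ⇒ R₀ B
  RF f = mk (R₁ f) (R₁-cong f)

  μF : ∀ A → R₀ (R₀ A) ⇒ R₀ A
  μF A = mk (μ A) (μ-cong A)

  ηF : ∀ A → A ⇒ R₀ A
  ηF A = mk (η A) (η-cong A)

  γ : ∀ A → ∣ Opt (R₀ A) ∣ → ∣ R₀ (Opt A) ∣
  γ A (inj₁ r) = R₁ inlF r
  γ A (inj₂ _) = η (Opt A) (inj₂ tt)

  γ-cong : ∀ A → Cong (Opt (R₀ A)) (R₀ (Opt A)) (γ A)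
  γ-cong A (inj₁ p) = R₁-cong inlF p
  γ-cong A (inj₂ _) = Setoid.refl (R₀ (Opt A))

  γF : ∀ A → Opt (R₀ A) ⇒ R₀ (Opt A)
  γF A = mk (γ A) (γ-cong A)

  -- the left R-module structure of the derivative R' (R'(X) = R(X+{*}))
  ρ' : ∀ A → ∣ R₀ (Opt (R₀ A)) ∣ → ∣ R₀ (Opt A) ∣
  ρ' A x = μ (Opt A) (R₁ (γF A) x)

  record ExpLaws : Set₁ where
    field
      R₁-resp : ∀ {A B} {f g : A ⇒ B} → (∀ x → Eq B (Func.to f x) (Func.to g x))
                → ∀ x → Eq (R₀ B) (R₁ f x) (R₁ g x)
      R₁-id   : ∀ {A} x → Eq (R₀ A) (R₁ (idF {A}) x) x
      R₁-∘    : ∀ {A B C} (f : A ⇒ B) (g : B ⇒ C) x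
                → Eq (R₀ C) (R₁ (g ∘F f) x) (R₁ g (R₁ f x))
      μ-nat : ∀ {A B} (f : A ⇒ B) x → Eq (R₀ B) (μ B (R₁ (RF f) x)) (R₁ f (μ A x))
      η-nat : ∀ {A B} (f : A ⇒ B) x → Eq (R₀ B) (η B (Func.to f x)) (R₁ f (η A x))
      μ-assoc : ∀ A x → Eq (R₀ A) (μ A (R₁ (μF A) x)) (μ A (μ (R₀ A) x))
      μ-ηR    : ∀ A x → Eq (R₀ A) (μ A (η (R₀ A) x)) x
      μ-Rη    : ∀ A x → Eq (R₀ A) (μ A (R₁ (ηF A) x)) x
      exp-nat : ∀ {A B} (f : A ⇒ B) x
                → Eq (R₀ B) (exp B (R₁ (optF f) x)) (R₁ f (exp A x))
      exp-lin : ∀ A x → Eq (R₀ A) (μ A (exp (R₀ A) x)) (exp A (ρ' A x))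
      exp-inv      : ∀ A → ∣ R₀ A ∣ → ∣ R₀ (Opt A) ∣
      exp-inv-cong : ∀ A → Cong (R₀ A) (R₀ (Opt A)) (exp-inv A)
      exp-inv-l    : ∀ A x → Eq (R₀ A) (exp A (exp-inv A x)) x
      exp-inv-r    : ∀ A x → Eq (R₀ (Opt A)) (exp-inv A (exp A x)) x

record ExpMonad : Set₁ where
  field
    dat  : ExpMonadData
    setd : Setoidal dat
    laws : Laws.ExpLaws dat setd

record Hom (R P : ExpMonad) : Set₁ where
  private
    module Rm = ExpMonadData (ExpMonad.dat R)
    module Pm = ExpMonadData (ExpMonad.dat P)
  field
    φ      : ∀ A → ∣ Rm.R₀ A ∣ → ∣ Pm.R₀ A ∣
    φ-cong : ∀ A → Cong (Rm.R₀ A) (Pm.R₀ A) (φ A)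
    φ-nat  : ∀ {A B} (f : A ⇒ B) x → Eq (Pm.R₀ B) (φ B (Rm.R₁ f x)) (Pm.R₁ f (φ A x))
    -- monad morphism:  φ ∘ μ_R = μ_P ∘ (φφ),  (φφ)_X = P(φ_X) ∘ φ_{R X}
    φ-μ    : ∀ A x → Eq (Pm.R₀ A) (φ A (Rm.μ A x))
                        (Pm.μ A (Pm.R₁ (mk (φ A) (φ-cong A)) (φ (Rm.R₀ A) x)))
    φ-η    : ∀ A x → Eq (Pm.R₀ A) (φ A (Rm.η A x)) (Pm.η A x)
    φ-exp  : ∀ A x → Eq (Pm.R₀ A) (φ A (Rm.exp A x)) (Pm.exp A (φ (Opt A) x))

HomEq : {R P : ExpMonad} → Hom R P → Hom R P → Set₁
HomEq {R} {P} f g = ∀ A x → Eq (ExpMonadData.R₀ (ExpMonad.dat P) A) (Hom.φ f A x) (Hom.φ g A x)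

IsInitial : ExpMonad → Set₁
IsInitial R = ∀ (P : ExpMonad) → Σ (Hom R P) (λ f → ∀ (g : Hom R P) → HomEq f g)

-- Untyped λ-terms (nested de Bruijn syntax; α-equivalence is syntactic)

data Term (X : Set) : Set where
  var : X → Term X
  app : Term X → Term X → Term X
  lam : Term (X ⊎ ⊤) → Term X

ren : ∀ {X Y : Set} → (X → Y) → Term X → Term Y
ren f (var x)   = var (f x)
ren f (app s t) = app (ren f s) (ren f t)
ren f (lam s)   = lam (ren (Sum.map f (λ u → u)) s)

liftS : ∀ {X Y : Set} → (X → Term Y) → X ⊎ ⊤ → Term (Y ⊎ ⊤)
liftS σ (inj₁ x) = ren inj₁ (σ x)
liftS σ (inj₂ u) = var (inj₂ u)

sub : ∀ {X Y : Set} → (X → Term Y) → Term X → Term Y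
sub σ (var x)   = σ x
sub σ (app s t) = app (sub σ s) (sub σ t)
sub σ (lam s)   = lam (sub (liftS σ) s)

_[_] : ∀ {X : Set} → Term (X ⊎ ⊤) → Term X → Term X
s [ t ] = sub (λ { (inj₁ x) → var x ; (inj₂ _) → t }) s

-- βη-convertibility, relative to an equality E on the variables:
-- the least equivalence relation containing E on variables, closed under
-- application and abstraction, and containing β and η.
data BE {X : Set} (E : X → X → Set) : Term X → Term X → Set where
  var   : ∀ {x y} → E x y → BE E (var x) (var y)
  app   : ∀ {s s' t t'} → BE E s s' → BE E t t' → BE E (app s t) (app s' t')
  lam   : ∀ {s s'} → BE (Pointwise E _≡_) s s' → BE E (lam s) (lam s')
  β     : ∀ {s t} → BE E (app (lam s) t) (s [ t ])
  η     : ∀ {s} → BE E (lam (app (ren inj₁ s) (var (inj₂ tt)))) s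
  refl  : ∀ {s} → BE E s s
  sym   : ∀ {s t} → BE E s t → BE E t s
  trans : ∀ {s t u} → BE E s t → BE E t u → BE E s u

ΛS : Obj → Obj
ΛS A = record
  { Carrier = Term ∣ A ∣
  ; _≈_ = BE (Eq A)
  ; isEquivalence = record { refl = refl ; sym = sym ; trans = trans }
  }

ΛD : ExpMonadData
ΛD = record
  { R₀  = ΛS
  ; R₁  = λ f → ren (Func.to f)
  ; μ   = λ A → sub (λ t → t)
  ; η   = λ A → var
  ; exp = λ A → lam
  }

ΛM : (s : Setoidal ΛD) → Laws.ExpLaws ΛD s → ExpMonad
ΛM s l = record { dat = ΛD ; setd = s ; laws = l }

-- Λ is an exponential monad because renaming and substitution respect βη,
-- and abs is inverted by η-expansion.  In any exponential monad P the inverse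
-- of exp yields an application  u · v = μ (P[v/*] (exp⁻¹ u))  satisfying β
-- and η, so interpreting variables by η, application by · and abstraction by
-- exp respects βη and commutes with substitution: it is a morphism Λ → P.
-- Every morphism preserves η and exp, hence exp⁻¹ and ·, so it agrees with
-- the interpretation by induction on terms.
module Submission where

open import Defs hiding (η)
open import Data.Product.Base using (Σ; _,_)
open import Relation.Binary.Bundles using (Setoid)
open import Function.Base using (_∘_)
open import Function.Bundles using (Func)
open import Data.Sum.Base using (_⊎_; inj₁; inj₂; map₁)
open import Data.Sum.Relation.Binary.Pointwise using (inj₁; inj₂)
open import Data.Unit.Base using (⊤; tt)
open import Relation.Binary.PropositionalEquality as PE using (_≡_; _≗_)
import Relation.Binary.Reasoning.Setoid as ≈-Reasoning

-- Renaming and substitution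

ren-ren : ∀ {X Y Z : Set} {f : X → Y} {g : Y → Z} {h : X → Z}
        → g ∘ f ≗ h → ∀ s → ren g (ren f s) ≡ ren h s
ren-ren H (var x)   = PE.cong var (H x)
ren-ren H (app s t) = PE.cong₂ app (ren-ren H s) (ren-ren H t)
ren-ren H (lam s)   =
  PE.cong lam (ren-ren (λ { (inj₁ x) → PE.cong inj₁ (H x) ; (inj₂ _) → PE.refl }) s)

ren-id : ∀ {X : Set} {f : X → X} → (∀ x → f x ≡ x) → ∀ s → ren f s ≡ s
ren-id H (var x)   = PE.cong var (H x)
ren-id H (app s t) = PE.cong₂ app (ren-id H s) (ren-id H t)
ren-id H (lam s)   =
  PE.cong lam (ren-id (λ { (inj₁ x) → PE.cong inj₁ (H x) ; (inj₂ _) → PE.refl }) s)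

sub-ext : ∀ {X Y : Set} {σ ρ : X → Term Y} → σ ≗ ρ → ∀ s → sub σ s ≡ sub ρ s
sub-ext H (var x)   = H x
sub-ext H (app s t) = PE.cong₂ app (sub-ext H s) (sub-ext H t)
sub-ext H (lam s)   =
  PE.cong lam (sub-ext (λ { (inj₁ x) → PE.cong (ren inj₁) (H x) ; (inj₂ _) → PE.refl }) s)

sub-ren : ∀ {X Y Z : Set} {σ : Y → Term Z} {f : X → Y} {ρ : X → Term Z}
        → σ ∘ f ≗ ρ → ∀ s → sub σ (ren f s) ≡ sub ρ s
sub-ren H (var x)   = H x
sub-ren H (app s t) = PE.cong₂ app (sub-ren H s) (sub-ren H t)
sub-ren H (lam s)   =
  PE.cong lam (sub-ren (λ { (inj₁ x) → PE.cong (ren inj₁) (H x) ; (inj₂ _) → PE.refl }) s)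

ren-sub : ∀ {X Y Z : Set} {f : Y → Z} {σ : X → Term Y} {ρ : X → Term Z}
        → ren f ∘ σ ≗ ρ → ∀ s → ren f (sub σ s) ≡ sub ρ s
ren-sub H (var x)   = H x
ren-sub H (app s t) = PE.cong₂ app (ren-sub H s) (ren-sub H t)
ren-sub {f = f} {σ} H (lam s) = PE.cong lam (ren-sub H′ s)
  where
  H′ : ren (map₁ f) ∘ liftS σ ≗ liftS _
  H′ (inj₁ x) = PE.trans (ren-ren (λ _ → PE.refl) (σ x))
                  (PE.trans (PE.sym (ren-ren (λ _ → PE.refl) (σ x))) (PE.cong (ren inj₁) (H x)))
  H′ (inj₂ _) = PE.refl

sub-sub : ∀ {X Y Z : Set} {σ : X → Term Y} {τ : Y → Term Z} {ρ : X → Term Z}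
        → sub τ ∘ σ ≗ ρ → ∀ s → sub τ (sub σ s) ≡ sub ρ s
sub-sub H (var x)   = H x
sub-sub H (app s t) = PE.cong₂ app (sub-sub H s) (sub-sub H t)
sub-sub {σ = σ} {τ} H (lam s) = PE.cong lam (sub-sub H′ s)
  where
  H′ : sub (liftS τ) ∘ liftS σ ≗ liftS _
  H′ (inj₁ x) = PE.trans (sub-ren (λ _ → PE.refl) (σ x))
                  (PE.trans (PE.sym (ren-sub (λ _ → PE.refl) (σ x))) (PE.cong (ren inj₁) (H x)))
  H′ (inj₂ _) = PE.refl

sub-var : ∀ {X : Set} {σ : X → Term X} → σ ≗ var → ∀ s → sub σ s ≡ s
sub-var H (var x)   = H x
sub-var H (app s t) = PE.cong₂ app (sub-var H s) (sub-var H t)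
sub-var H (lam s)   =
  PE.cong lam (sub-var (λ { (inj₁ x) → PE.cong (ren inj₁) (H x) ; (inj₂ _) → PE.refl }) s)

sub-ren-var : ∀ {X Y : Set} {σ : Y → Term X} {f : X → Y}
            → σ ∘ f ≗ var → ∀ s → sub σ (ren f s) ≡ s
sub-ren-var H s = PE.trans (sub-ren H s) (sub-var (λ _ → PE.refl) s)

weaken : ∀ {X : Set} → Term X → Term (X ⊎ ⊤)
weaken = ren inj₁

ren-weaken : ∀ {X Y : Set} (f : X → Y) s → ren (map₁ f) (weaken s) ≡ weaken (ren f s)
ren-weaken f s = PE.trans (ren-ren (λ _ → PE.refl) s) (PE.sym (ren-ren (λ _ → PE.refl) s))

sub-weaken : ∀ {X Y : Set} (σ : X → Term Y) s → sub (liftS σ) (weaken s) ≡ weaken (sub σ s)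
sub-weaken σ s = PE.trans (sub-ren (λ _ → PE.refl) s) (PE.sym (ren-sub (λ _ → PE.refl) s))

single : ∀ {X : Set} → Term X → X ⊎ ⊤ → Term X
single t (inj₁ x) = var x
single t (inj₂ _) = t

[]-as-sub : ∀ {X : Set} (s : Term (X ⊎ ⊤)) t → s [ t ] ≡ sub (single t) s
[]-as-sub s t = sub-ext (λ { (inj₁ x) → PE.refl ; (inj₂ _) → PE.refl }) s

ren-[] : ∀ {X Y : Set} (f : X → Y) s t → ren f (s [ t ]) ≡ ren (map₁ f) s [ ren f t ]
ren-[] f s t = begin
  ren f (s [ t ])                          ≡⟨ PE.cong (ren f) ([]-as-sub s t) ⟩
  ren f (sub (single t) s)                 ≡⟨ ren-sub (λ { (inj₁ _) → PE.refl ; (inj₂ _) → PE.refl }) s ⟩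
  sub (single (ren f t) ∘ map₁ f) s        ≡⟨ sub-ren (λ _ → PE.refl) s ⟨
  sub (single (ren f t)) (ren (map₁ f) s)  ≡⟨ []-as-sub (ren (map₁ f) s) (ren f t) ⟨
  ren (map₁ f) s [ ren f t ]               ∎
  where open PE.≡-Reasoning

sub-[] : ∀ {X Y : Set} (σ : X → Term Y) s t → sub σ (s [ t ]) ≡ sub (liftS σ) s [ sub σ t ]
sub-[] σ s t = begin
  sub σ (s [ t ])                                 ≡⟨ PE.cong (sub σ) ([]-as-sub s t) ⟩
  sub σ (sub (single t) s)                        ≡⟨ sub-sub (λ _ → PE.refl) s ⟩
  sub (sub σ ∘ single t) s                        ≡⟨ sub-ext instantiate s ⟩
  sub (sub (single (sub σ t)) ∘ liftS σ) s        ≡⟨ sub-sub (λ _ → PE.refl) s ⟨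
  sub (single (sub σ t)) (sub (liftS σ) s)        ≡⟨ []-as-sub (sub (liftS σ) s) (sub σ t) ⟨
  sub (liftS σ) s [ sub σ t ]                     ∎
  where
  open PE.≡-Reasoning
  instantiate : sub σ ∘ single t ≗ sub (single (sub σ t)) ∘ liftS σ
  instantiate (inj₁ x) = PE.sym (sub-ren-var (λ _ → PE.refl) (σ x))
  instantiate (inj₂ _) = PE.refl

≡⇒BE : ∀ {X : Set} {E : X → X → Set} {s t : Term X} → s ≡ t → BE E s t
≡⇒BE PE.refl = refl

ren-cong : ∀ {A B : Obj} (f : A ⇒ B) {s s′}
         → BE (Eq A) s s′ → BE (Eq B) (ren (Func.to f) s) (ren (Func.to f) s′)
ren-cong f (var p)     = var (Func.cong f p)
ren-cong f (app p q)   = app (ren-cong f p) (ren-cong f q)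
ren-cong f (lam p)     = lam (ren-cong (optF f) p)
ren-cong f (β {s} {t}) = trans β (≡⇒BE (PE.sym (ren-[] (Func.to f) s t)))
ren-cong f (BE.η {s})  = trans (lam (app (≡⇒BE (ren-weaken (Func.to f) s)) refl)) BE.η
ren-cong f refl        = refl
ren-cong f (sym p)     = sym (ren-cong f p)
ren-cong f (trans p q) = trans (ren-cong f p) (ren-cong f q)

ren-pointwise : ∀ {A B : Obj} {f g : ∣ A ∣ → ∣ B ∣}
              → (∀ x → Eq B (f x) (g x)) → ∀ s → BE (Eq B) (ren f s) (ren g s)
ren-pointwise H (var x)           = var (H x)
ren-pointwise {A} {B} H (app s t) = app (ren-pointwise {A} {B} H s) (ren-pointwise {A} {B} H t)
ren-pointwise {A} {B} H (lam s)   =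
  lam (ren-pointwise {Opt A} {Opt B} (λ { (inj₁ x) → inj₁ (H x) ; (inj₂ _) → inj₂ PE.refl }) s)

liftF : ∀ {A B : Obj} → A ⇒ ΛS B → Opt A ⇒ ΛS (Opt B)
liftF {A} {B} σ = mk (liftS (Func.to σ)) lift-cong
  where
  lift-cong : Cong (Opt A) (ΛS (Opt B)) (liftS (Func.to σ))
  lift-cong (inj₁ p) = ren-cong (inlF {B}) (Func.cong σ p)
  lift-cong (inj₂ _) = refl

sub-cong : ∀ {A B : Obj} (σ : A ⇒ ΛS B) {s s′}
         → BE (Eq A) s s′ → BE (Eq B) (sub (Func.to σ) s) (sub (Func.to σ) s′)
sub-cong σ (var p)             = Func.cong σ p
sub-cong {A} {B} σ (app p q)   = app (sub-cong {A} {B} σ p) (sub-cong {A} {B} σ q)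
sub-cong {A} {B} σ (lam p)     = lam (sub-cong {Opt A} {Opt B} (liftF {A} {B} σ) p)
sub-cong σ (β {s} {t})         = trans β (≡⇒BE (PE.sym (sub-[] (Func.to σ) s t)))
sub-cong σ (BE.η {s})          = trans (lam (app (≡⇒BE (sub-weaken (Func.to σ) s)) refl)) BE.η
sub-cong σ refl                = refl
sub-cong {A} {B} σ (sym p)     = sym (sub-cong {A} {B} σ p)
sub-cong {A} {B} σ (trans p q) = trans (sub-cong {A} {B} σ p) (sub-cong {A} {B} σ q)

ΛSetoidal : Setoidal ΛD
ΛSetoidal = record
  { R₁-cong  = ren-cong
  ; μ-cong   = λ A → sub-cong {ΛS A} {A} idF
  ; η-cong   = λ A → var
  ; exp-cong = λ A → lam
  }

ΛLaws : Laws.ExpLaws ΛD ΛSetoidal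
ΛLaws = record
  { R₁-resp      = λ {A} {B} → ren-pointwise {A} {B}
  ; R₁-id        = λ s → ≡⇒BE (ren-id (λ _ → PE.refl) s)
  ; R₁-∘         = λ f g s → ≡⇒BE (PE.sym (ren-ren (λ _ → PE.refl) s))
  ; μ-nat        = λ f s → ≡⇒BE (PE.trans (sub-ren (λ _ → PE.refl) s)
                                         (PE.sym (ren-sub (λ _ → PE.refl) s)))
  ; η-nat        = λ f x → refl
  ; μ-assoc      = λ A s → ≡⇒BE (PE.trans (sub-ren (λ _ → PE.refl) s)
                                         (PE.sym (sub-sub (λ _ → PE.refl) s)))
  ; μ-ηR         = λ A s → refl
  ; μ-Rη         = λ A s → ≡⇒BE (sub-ren-var (λ _ → PE.refl) s)
  ; exp-nat      = λ f s → refl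
  ; exp-lin      = λ A s → lam (≡⇒BE (PE.trans (sub-ext lift-id≗γ s)
                                               (PE.sym (sub-ren (λ _ → PE.refl) s))))
  ; exp-inv      = λ A s → app (weaken s) (var (inj₂ tt))
  ; exp-inv-cong = λ A p → app (ren-cong (inlF {A}) p) refl
  ; exp-inv-l    = λ A s → BE.η
  ; exp-inv-r    = λ A s → trans β (≡⇒BE (η-expand-β s))
  }
  where
  lift-id≗γ : ∀ {A} → liftS (λ (t : Term ∣ A ∣) → t) ≗ Laws.γ ΛD ΛSetoidal A
  lift-id≗γ (inj₁ _) = PE.refl
  lift-id≗γ (inj₂ _) = PE.refl

  η-expand-β : ∀ {X : Set} (s : Term (X ⊎ ⊤)) → ren (map₁ inj₁) s [ var (inj₂ tt) ] ≡ s
  η-expand-β s = PE.trans ([]-as-sub (ren (map₁ inj₁) s) (var (inj₂ tt)))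
                          (sub-ren-var (λ { (inj₁ _) → PE.refl ; (inj₂ _) → PE.refl }) s)

ΛExp : ExpMonad
ΛExp = ΛM ΛSetoidal ΛLaws

-- Kleisli extension and application in an exponential monad

module ExpMonadKit (M : ExpMonad) where
  open ExpMonad M using (dat; setd; laws)
  open ExpMonadData dat public
  open Setoidal setd public
  open Laws dat setd public
  open ExpLaws laws public

  module _ {A : Obj} where
    open Setoid (R₀ A) public using ()
      renaming (refl to ≈-refl; sym to ≈-sym; trans to ≈-trans; reflexive to ≈-reflexive)

  R₁-cong₂ : ∀ {A B} {f g : A ⇒ B} → (∀ x → Eq B (Func.to f x) (Func.to g x))
           → ∀ {z z′} → Eq (R₀ A) z z′ → Eq (R₀ B) (R₁ f z) (R₁ g z′)
  R₁-cong₂ {g = g} H {z} p = ≈-trans (R₁-resp H z) (R₁-cong g p)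

  bind : ∀ {A B} → A ⇒ R₀ B → ∣ R₀ A ∣ → ∣ R₀ B ∣
  bind {B = B} f z = μ B (R₁ f z)

  bind-cong : ∀ {A B} {f g : A ⇒ R₀ B} → (∀ x → Eq (R₀ B) (Func.to f x) (Func.to g x))
            → ∀ {z z′} → Eq (R₀ A) z z′ → Eq (R₀ B) (bind f z) (bind g z′)
  bind-cong {B = B} H p = μ-cong B (R₁-cong₂ H p)

  bindF : ∀ {A B} → A ⇒ R₀ B → R₀ A ⇒ R₀ B
  bindF f = mk (bind f) (bind-cong (λ _ → ≈-refl))

  bind-unitˡ : ∀ {A B} (f : A ⇒ R₀ B) x → Eq (R₀ B) (bind f (η A x)) (Func.to f x)
  bind-unitˡ {A} {B} f x = ≈-trans (μ-cong B (≈-sym (η-nat f x))) (μ-ηR B (Func.to f x))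

  bind-unitʳ : ∀ {A} z → Eq (R₀ A) (bind (ηF A) z) z
  bind-unitʳ {A} = μ-Rη A

  bind-R₁ : ∀ {A B C} (g : B ⇒ R₀ C) (f : A ⇒ B) z
          → Eq (R₀ C) (bind g (R₁ f z)) (bind (g ∘F f) z)
  bind-R₁ {C = C} g f z = μ-cong C (≈-sym (R₁-∘ f g z))

  R₁-as-bind : ∀ {A B} (f : A ⇒ B) z → Eq (R₀ B) (R₁ f z) (bind (ηF B ∘F f) z)
  R₁-as-bind {B = B} f z = ≈-trans (≈-sym (bind-unitʳ (R₁ f z))) (bind-R₁ (ηF B) f z)

  bind-assoc : ∀ {A B C} (f : B ⇒ R₀ C) (g : A ⇒ R₀ B) z
             → Eq (R₀ C) (bind f (bind g z)) (bind (bindF f ∘F g) z)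
  bind-assoc {C = C} f g z = begin
    μ C (R₁ f (μ _ (R₁ g z)))               ≈⟨ μ-cong C (μ-nat f (R₁ g z)) ⟨
    μ C (μ (R₀ C) (R₁ (RF f) (R₁ g z)))     ≈⟨ μ-assoc C (R₁ (RF f) (R₁ g z)) ⟨
    μ C (R₁ (μF C) (R₁ (RF f) (R₁ g z)))    ≈⟨ bind-R₁ (μF C) (RF f) (R₁ g z) ⟩
    bind (μF C ∘F RF f) (R₁ g z)            ≈⟨ bind-R₁ (μF C ∘F RF f) g z ⟩
    bind ((μF C ∘F RF f) ∘F g) z            ≈⟨ bind-cong (λ _ → ≈-refl) ≈-refl ⟩
    bind (bindF f ∘F g) z                   ∎
    where open ≈-Reasoning (R₀ C)

  bind-exp : ∀ {A B} (τ : A ⇒ R₀ B) w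
           → Eq (R₀ B) (bind τ (exp A w)) (exp B (bind (γF B ∘F optF τ) w))
  bind-exp {B = B} τ w = begin
    μ B (R₁ τ (exp _ w))                 ≈⟨ μ-cong B (exp-nat τ w) ⟨
    μ B (exp (R₀ B) (R₁ (optF τ) w))     ≈⟨ exp-lin B (R₁ (optF τ) w) ⟩
    exp B (ρ' B (R₁ (optF τ) w))         ≈⟨ exp-cong B (bind-R₁ (γF B) (optF τ) w) ⟩
    exp B (bind (γF B ∘F optF τ) w)      ∎
    where open ≈-Reasoning (R₀ B)

  exp-inv-unique : ∀ {A u v} → Eq (R₀ A) (exp A u) v → Eq (R₀ (Opt A)) (exp-inv A v) u
  exp-inv-unique {A} {u} e = ≈-trans (exp-inv-cong A (≈-sym e)) (exp-inv-r A u)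

  exp-inv-R₁ : ∀ {A B} (f : A ⇒ B) u
             → Eq (R₀ (Opt B)) (exp-inv B (R₁ f u)) (R₁ (optF f) (exp-inv A u))
  exp-inv-R₁ {A} f u =
    exp-inv-unique (≈-trans (exp-nat f (exp-inv A u)) (R₁-cong f (exp-inv-l A u)))

  exp-inv-bind : ∀ {A B} (τ : A ⇒ R₀ B) u
               → Eq (R₀ (Opt B)) (exp-inv B (bind τ u)) (bind (γF B ∘F optF τ) (exp-inv A u))
  exp-inv-bind {A} τ u =
    exp-inv-unique (≈-trans (≈-sym (bind-exp τ (exp-inv A u)))
                            (bind-cong (λ _ → ≈-refl) (exp-inv-l A u)))

  singleF : ∀ {A} → ∣ R₀ A ∣ → Opt A ⇒ R₀ A
  singleF {A} v = mk to to-cong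
    where
    to : ∣ Opt A ∣ → ∣ R₀ A ∣
    to (inj₁ x) = η A x
    to (inj₂ _) = v
    to-cong : Cong (Opt A) (R₀ A) to
    to-cong (inj₁ p) = η-cong A p
    to-cong (inj₂ _) = ≈-refl

  infixl 9 _·_
  _·_ : ∀ {A} → ∣ R₀ A ∣ → ∣ R₀ A ∣ → ∣ R₀ A ∣
  _·_ {A} u v = bind (singleF v) (exp-inv A u)

  ·-cong : ∀ {A} {u u′ v v′ : ∣ R₀ A ∣} → Eq (R₀ A) u u′ → Eq (R₀ A) v v′
         → Eq (R₀ A) (u · v) (u′ · v′)
  ·-cong {A} p q = bind-cong (λ { (inj₁ _) → ≈-refl ; (inj₂ _) → q }) (exp-inv-cong A p)

  ·-β : ∀ {A} u v → Eq (R₀ A) (exp A u · v) (bind (singleF v) u)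
  ·-β {A} u v = bind-cong (λ _ → ≈-refl) (exp-inv-r A u)

  weaken-·-var : ∀ {A} u → Eq (R₀ (Opt A)) (R₁ inlF u · η (Opt A) (inj₂ tt)) (exp-inv A u)
  weaken-·-var {A} u = begin
    bind (singleF *) (exp-inv (Opt A) (R₁ inlF u))
      ≈⟨ bind-cong (λ _ → ≈-refl) (exp-inv-R₁ inlF u) ⟩
    bind (singleF *) (R₁ (optF inlF) (exp-inv A u))
      ≈⟨ bind-R₁ (singleF *) (optF inlF) (exp-inv A u) ⟩
    bind (singleF * ∘F optF inlF) (exp-inv A u)
      ≈⟨ bind-cong (λ { (inj₁ _) → ≈-refl ; (inj₂ _) → ≈-refl }) ≈-refl ⟩
    bind (ηF (Opt A)) (exp-inv A u)
      ≈⟨ bind-unitʳ (exp-inv A u) ⟩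
    exp-inv A u
      ∎
    where
    open ≈-Reasoning (R₀ (Opt A))
    * = η (Opt A) (inj₂ tt)

  ·-η : ∀ {A} u → Eq (R₀ A) (exp A (R₁ inlF u · η (Opt A) (inj₂ tt))) u
  ·-η {A} u = ≈-trans (exp-cong A (weaken-·-var u)) (exp-inv-l A u)

  bind-· : ∀ {A B} (τ : A ⇒ R₀ B) u v → Eq (R₀ B) (bind τ (u · v)) (bind τ u · bind τ v)
  bind-· {A} {B} τ u v = begin
    bind τ (bind (singleF v) (exp-inv A u))
      ≈⟨ bind-assoc τ (singleF v) (exp-inv A u) ⟩
    bind (bindF τ ∘F singleF v) (exp-inv A u)
      ≈⟨ bind-cong shift ≈-refl ⟩
    bind (bindF (singleF (bind τ v)) ∘F τ′) (exp-inv A u)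
      ≈⟨ bind-assoc (singleF (bind τ v)) τ′ (exp-inv A u) ⟨
    bind (singleF (bind τ v)) (bind τ′ (exp-inv A u))
      ≈⟨ bind-cong (λ _ → ≈-refl) (exp-inv-bind τ u) ⟨
    bind (singleF (bind τ v)) (exp-inv B (bind τ u))
      ∎
    where
    open ≈-Reasoning (R₀ B)
    τ′ = γF B ∘F optF τ
    shift : ∀ x → Eq (R₀ B) (bind τ (Func.to (singleF v) x))
                            (bind (singleF (bind τ v)) (Func.to τ′ x))
    shift (inj₁ x) = begin
      bind τ (η A x)                                     ≈⟨ bind-unitˡ τ x ⟩
      Func.to τ x                                        ≈⟨ bind-unitʳ (Func.to τ x) ⟨
      bind (ηF B) (Func.to τ x)                          ≈⟨ bind-cong (λ _ → ≈-refl) ≈-refl ⟩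
      bind (singleF (bind τ v) ∘F inlF) (Func.to τ x)
        ≈⟨ bind-R₁ (singleF (bind τ v)) inlF (Func.to τ x) ⟨
      bind (singleF (bind τ v)) (R₁ inlF (Func.to τ x))  ∎
    shift (inj₂ _) = ≈-sym (bind-unitˡ (singleF (bind τ v)) (inj₂ tt))

  R₁-· : ∀ {A B} (f : A ⇒ B) u v → Eq (R₀ B) (R₁ f (u · v)) (R₁ f u · R₁ f v)
  R₁-· {B = B} f u v = begin
    R₁ f (u · v)                             ≈⟨ R₁-as-bind f (u · v) ⟩
    bind (ηF B ∘F f) (u · v)                 ≈⟨ bind-· (ηF B ∘F f) u v ⟩
    bind (ηF B ∘F f) u · bind (ηF B ∘F f) v  ≈⟨ ·-cong (R₁-as-bind f u) (R₁-as-bind f v) ⟨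
    R₁ f u · R₁ f v                          ∎
    where open ≈-Reasoning (R₀ B)

-- Initiality of Λ

module HomProperties {R P : ExpMonad} (f : Hom R P) where
  private
    module R = ExpMonadKit R
    module P = ExpMonadKit P
  open Hom f

  φF : ∀ A → R.R₀ A ⇒ P.R₀ A
  φF A = mk (φ A) (φ-cong A)

  φ-bind : ∀ {A B} (σ : A ⇒ R.R₀ B) z
         → Eq (P.R₀ B) (φ B (R.bind σ z)) (P.bind (φF B ∘F σ) (φ A z))
  φ-bind {A} {B} σ z = begin
    φ B (R.μ B (R.R₁ σ z))                       ≈⟨ φ-μ B (R.R₁ σ z) ⟩
    P.bind (φF B) (φ (R.R₀ B) (R.R₁ σ z))        ≈⟨ P.bind-cong (λ _ → P.≈-refl) (φ-nat σ z) ⟩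
    P.bind (φF B) (P.R₁ σ (φ A z))               ≈⟨ P.bind-R₁ (φF B) σ (φ A z) ⟩
    P.bind (φF B ∘F σ) (φ A z)                   ∎
    where open ≈-Reasoning (P.R₀ B)

  φ-exp-inv : ∀ {A} u → Eq (P.R₀ (Opt A)) (φ (Opt A) (R.exp-inv A u)) (P.exp-inv A (φ A u))
  φ-exp-inv {A} u =
    P.≈-sym (P.exp-inv-unique (P.≈-trans (P.≈-sym (φ-exp A (R.exp-inv A u)))
                                         (φ-cong A (R.exp-inv-l A u))))

  φ-· : ∀ {A} u v → Eq (P.R₀ A) (φ A (u R.· v)) (φ A u P.· φ A v)
  φ-· {A} u v =
    P.≈-trans (φ-bind (R.singleF v) (R.exp-inv A u))
              (P.bind-cong (λ { (inj₁ x) → φ-η A x ; (inj₂ _) → P.≈-refl }) (φ-exp-inv u))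

module Λ = ExpMonadKit ΛExp

app-≈-· : ∀ {A : Obj} s t → BE (Eq A) (app s t) (Λ._·_ {A} s t)
app-≈-· s t = app (≡⇒BE (PE.sym (PE.trans (sub-ren (λ _ → PE.refl) (weaken s))
                                           (sub-ren-var (λ _ → PE.refl) s))))
                  refl

module Initiality (P : ExpMonad) where
  open ExpMonadKit P

  interpret : ∀ A → Term ∣ A ∣ → ∣ R₀ A ∣
  interpret A (var x)   = η A x
  interpret A (app s t) = interpret A s · interpret A t
  interpret A (lam s)   = exp A (interpret (Opt A) s)

  interpret-ren : ∀ {A B} (f : A ⇒ B) s
                → Eq (R₀ B) (interpret B (ren (Func.to f) s)) (R₁ f (interpret A s))
  interpret-ren f (var x)   = η-nat f x
  interpret-ren f (app s t) =
    ≈-trans (·-cong (interpret-ren f s) (interpret-ren f t)) (≈-sym (R₁-· f _ _))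
  interpret-ren {A} {B} f (lam s) =
    ≈-trans (exp-cong B (interpret-ren (optF f) s)) (exp-nat f (interpret (Opt A) s))

  interpret-sub : ∀ {A B} (σ : ∣ A ∣ → Term ∣ B ∣) (τ : A ⇒ R₀ B)
                → (∀ x → Eq (R₀ B) (interpret B (σ x)) (Func.to τ x))
                → ∀ s → Eq (R₀ B) (interpret B (sub σ s)) (bind τ (interpret A s))
  interpret-sub σ τ H (var x)   = ≈-trans (H x) (≈-sym (bind-unitˡ τ x))
  interpret-sub σ τ H (app s t) =
    ≈-trans (·-cong (interpret-sub σ τ H s) (interpret-sub σ τ H t)) (≈-sym (bind-· τ _ _))
  interpret-sub {A} {B} σ τ H (lam s) =
    ≈-trans (exp-cong B (interpret-sub (liftS σ) (γF B ∘F optF τ) H′ s))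
            (≈-sym (bind-exp τ (interpret (Opt A) s)))
    where
    H′ : ∀ x → Eq (R₀ (Opt B)) (interpret (Opt B) (liftS σ x)) (Func.to (γF B ∘F optF τ) x)
    H′ (inj₁ x) = ≈-trans (interpret-ren inlF (σ x)) (R₁-cong inlF (H x))
    H′ (inj₂ _) = ≈-refl

  interpret-cong : ∀ {A s s′} → BE (Eq A) s s′ → Eq (R₀ A) (interpret A s) (interpret A s′)
  interpret-cong {A} (var p)     = η-cong A p
  interpret-cong (app p q)       = ·-cong (interpret-cong p) (interpret-cong q)
  interpret-cong {A} (lam p)     = exp-cong A (interpret-cong p)
  interpret-cong {A} (β {s} {t}) = begin
    exp A ⟦s⟧ · ⟦t⟧                 ≈⟨ ·-β ⟦s⟧ ⟦t⟧ ⟩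
    bind (singleF ⟦t⟧) ⟦s⟧          ≈⟨ interpret-sub (single t) (singleF ⟦t⟧) single-interpret s ⟨
    interpret A (sub (single t) s)  ≈⟨ ≈-reflexive (PE.cong (interpret A) ([]-as-sub s t)) ⟨
    interpret A (s [ t ])           ∎
    where
    open ≈-Reasoning (R₀ A)
    ⟦s⟧ = interpret (Opt A) s
    ⟦t⟧ = interpret A t
    single-interpret : ∀ x → Eq (R₀ A) (interpret A (single t x)) (Func.to (singleF ⟦t⟧) x)
    single-interpret (inj₁ _) = ≈-refl
    single-interpret (inj₂ _) = ≈-refl
  interpret-cong {A} (BE.η {s})  =
    ≈-trans (exp-cong A (·-cong (interpret-ren inlF s) ≈-refl)) (·-η (interpret A s))
  interpret-cong refl            = ≈-refl
  interpret-cong (sym p)         = ≈-sym (interpret-cong p)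
  interpret-cong (trans p q)     = ≈-trans (interpret-cong p) (interpret-cong q)

  interpretF : ∀ A → ΛS A ⇒ R₀ A
  interpretF A = mk (interpret A) interpret-cong

  interpret-hom : Hom ΛExp P
  interpret-hom = record
    { φ      = interpret
    ; φ-cong = λ A → interpret-cong
    ; φ-nat  = interpret-ren
    ; φ-μ    = λ A → interpret-sub (λ t → t) (interpretF A) (λ _ → ≈-refl)
    ; φ-η    = λ A x → ≈-refl
    ; φ-exp  = λ A s → ≈-refl
    }

  module _ (g : Hom ΛExp P) where
    open Hom g
    open HomProperties g

    interpret-unique : HomEq interpret-hom g
    interpret-unique A (var x)   = ≈-sym (φ-η A x)
    interpret-unique A (app s t) = begin
      interpret A s · interpret A t  ≈⟨ ·-cong (interpret-unique A s) (interpret-unique A t) ⟩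
      φ A s · φ A t                  ≈⟨ φ-· s t ⟨
      φ A (Λ._·_ {A} s t)            ≈⟨ φ-cong A (app-≈-· s t) ⟨
      φ A (app s t)                  ∎
      where open ≈-Reasoning (R₀ A)
    interpret-unique A (lam s)   =
      ≈-trans (exp-cong A (interpret-unique (Opt A) s)) (≈-sym (φ-exp A s))

theorem3 : Σ (Setoidal ΛD) (λ s → Σ (Laws.ExpLaws ΛD s) (λ l → IsInitial (ΛM s l)))
theorem3 = ΛSetoidal , ΛLaws , λ P → Initiality.interpret-hom P , Initiality.interpret-unique P
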